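{- Let $R$ be a totally ordered field, $A\in R^{m\times n}$, $b\in R^m$, and $\sigma$ a permutation of $\{1,\dots,m\}$. If $I$ and $I'$ are bases such that $\tilde x^I = \tilde x^{I'}$, then $I = I'$.
   Context: A basis is a subset $I=\{i_1<\dots<i_n\}\subseteq\{1,\dots,m\}$ of cardinality $n$ such that the $n\times n$ matrix $A_I$ with $k$-th row $A_{i_k}$ is invertible; for a matrix $B$ with $m$ rows, $B_I$ denotes the matrix with $k$-th row $B_{i_k}$. Let $P_\sigma\in R^{m\times m}$ be the permutation matrix with $(P_\sigma)_{i,j}=1$ if $j=\sigma(i)$ and $0$ otherwise, and $\tilde b=[\,b\mid -P_\sigma\,]\in R^{m\times(1+m)}$ (first column $b$). The perturbed basic point of a basis $I$ is $\tilde x^I = A_I^{ -1}\tilde b_I\in R^{n\times(1+m)}$. -}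

module Defs where

open import Level using (Level; _⊔_) renaming (suc to lsuc)
open import Data.Nat using (ℕ) renaming (zero to nzero; suc to nsuc)
open import Data.Fin using (Fin; _<_; _≟_) renaming (zero to fzero; suc to fsuc)
open import Data.Fin.Permutation using (Permutation′; _⟨$⟩ʳ_)
open import Data.Product using (Σ; _×_; _,_; proj₁)
open import Relation.Nullary using (¬_; yes; no)
open import Relation.Binary.PropositionalEquality using (_≡_)
open import Relation.Binary using (Rel)
open import Relation.Binary.Structures using (IsTotalOrder)
open import Algebra.Bundles using (CommutativeRing)

record OrderedField c ℓ₁ ℓ₂ : Set (lsuc (c ⊔ ℓ₁ ⊔ ℓ₂)) where
  field
    commutativeRing : CommutativeRing c ℓ₁
  open CommutativeRing commutativeRing public
  field
    _≤_           : Rel Carrier ℓ₂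
    1≉0           : ¬ (1# ≈ 0#)
    inverse       : ∀ x → ¬ (x ≈ 0#) → Σ Carrier λ y → (x * y) ≈ 1#
    isTotalOrder  : IsTotalOrder _≈_ _≤_
    +-mono-≤      : ∀ {x y} z → x ≤ y → (x + z) ≤ (y + z)
    *-nonneg      : ∀ {x y} → 0# ≤ x → 0# ≤ y → 0# ≤ (x * y)

module _ {c ℓ₁ ℓ₂} (F : OrderedField c ℓ₁ ℓ₂) where
  open OrderedField F

  Mat : ℕ → ℕ → Set c
  Mat r s = Fin r → Fin s → Carrier

  Σ[_] : ∀ {k} → (Fin k → Carrier) → Carrier
  Σ[_] {nzero} f = 0#
  Σ[_] {nsuc k} f = f fzero + Σ[_] (λ i → f (fsuc i))

  _⊗_ : ∀ {r s t} → Mat r s → Mat s t → Mat r t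
  _⊗_ M N i j = Σ[ (λ k → M i k * N k j) ]

  Id : ∀ {k} → Mat k k
  Id i j with i ≟ j
  ... | yes _ = 1#
  ... | no  _ = 0#

  _≈ₘ_ : ∀ {r s} → Mat r s → Mat r s → Set ℓ₁
  M ≈ₘ N = ∀ i j → M i j ≈ N i j

  rows : ∀ {m n s} → Mat m s → (Fin n → Fin m) → Mat n s
  rows B ι k j = B (ι k) j

  IsInverse : ∀ {k} → Mat k k → Mat k k → Set ℓ₁
  IsInverse M N = (_⊗_ M N ≈ₘ Id) × (_⊗_ N M ≈ₘ Id)

  -- A basis: I = {i_1 < ... < i_n} ⊆ {1..m}, encoded as its strictly increasing
  -- enumeration ι : Fin n → Fin m, with A_I invertible (witnessed by an inverse).
  StrictlyIncreasing : ∀ {m n} → (Fin n → Fin m) → Set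
  StrictlyIncreasing ι = ∀ {k l} → k < l → ι k < ι l

  record Basis {m n} (A : Mat m n) : Set (c ⊔ ℓ₁) where
    field
      ι          : Fin n → Fin m
      increasing : StrictlyIncreasing ι
      A_I⁻¹      : Mat n n
      invertible : IsInverse (rows A ι) A_I⁻¹

  Pσ : ∀ {m} → Permutation′ m → Mat m m
  Pσ σ i j with j ≟ (σ ⟨$⟩ʳ i)
  ... | yes _ = 1#
  ... | no  _ = 0#

  b̃ : ∀ {m} → (Fin m → Carrier) → Permutation′ m → Mat m (nsuc m)
  b̃ b σ i fzero    = b i
  b̃ b σ i (fsuc j) = - (Pσ σ i j)

  x̃ : ∀ {m n} (A : Mat m n) → (Fin m → Carrier) → Permutation′ m → Basis A → Mat n (nsuc m)
  x̃ A b σ I = _⊗_ (Basis.A_I⁻¹ I) (rows (b̃ b σ) (Basis.ι I))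

module Submission where

-- The permutation block of x̃^I = A_I⁻¹ b̃_I records the basis: for i ∈ I, the
-- column 1 + σ(i) of x̃^I is minus the column of A_I⁻¹ belonging to the row i,
-- which is nonzero because A_I⁻¹ is invertible; for i ∉ I that column is zero.
-- Hence x̃^I determines the set I, and a set has only one increasing enumeration.

open import Defs
open import Data.Nat using (ℕ; zero; suc; z≤n; s≤s) renaming (_<_ to _<ℕ_; _≤_ to _≤ℕ_)
open import Data.Nat.Properties using (≤-trans; ≤-antisym)
open import Data.Fin using (Fin; toℕ; inject₁; _<_; _≟_) renaming (zero to fzero; suc to fsuc)
open import Data.Fin.Properties
  using (<-cmp; <-irrefl; <-asym; any?; toℕ-inject₁; toℕ-injective; ≤̄⇒inject₁<; suc-injective)
  renaming (≤-refl to ≤ᶠ-refl)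
open import Data.Fin.Permutation using (Permutation′; _⟨$⟩ʳ_; _⟨$⟩ˡ_; inverseˡ)
open import Data.Product using (∃; _,_; proj₁; proj₂)
open import Data.Empty using (⊥-elim)
open import Function using (_∘_)
open import Relation.Nullary using (¬_; yes; no)
open import Relation.Binary.Core using (_Preserves_⟶_)
open import Relation.Binary.Definitions using (tri<; tri≈; tri>)
open import Relation.Binary.PropositionalEquality using (_≡_; refl; sym; trans; cong; subst₂)
import Algebra.Properties.Ring as RingProperties
import Relation.Binary.Reasoning.Setoid as SetoidReasoning

module _ {m n} {ι : Fin n → Fin m} (mono : ι Preserves _<_ ⟶ _<_) where

  strictMono⇒injective : ∀ {k l} → ι k ≡ ι l → k ≡ l
  strictMono⇒injective {k} {l} ιk≡ιl with <-cmp k l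
  ... | tri< k<l _ _ = ⊥-elim (<-irrefl ιk≡ιl (mono k<l))
  ... | tri≈ _ k≡l _ = k≡l
  ... | tri> _ _ l<k = ⊥-elim (<-irrefl (sym ιk≡ιl) (mono l<k))

  strictMono⇒reflects-< : ∀ {k l} → ι k < ι l → k < l
  strictMono⇒reflects-< {k} {l} ιk<ιl with <-cmp k l
  ... | tri< k<l _ _ = k<l
  ... | tri≈ _ refl _ = ⊥-elim (<-irrefl refl ιk<ιl)
  ... | tri> _ _ l<k = ⊥-elim (<-asym ιk<ιl (mono l<k))

inject₁-mono-< : ∀ {n} {k l : Fin n} → k < l → inject₁ k < inject₁ l
inject₁-mono-< {k = k} {l} = subst₂ _<ℕ_ (sym (toℕ-inject₁ k)) (sym (toℕ-inject₁ l))

strictMono⇒toℕ-≤ : ∀ {m n} {f : Fin n → Fin m} → f Preserves _<_ ⟶ _<_ →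
                   ∀ k → toℕ k ≤ℕ toℕ (f k)
strictMono⇒toℕ-≤ mono fzero    = z≤n
strictMono⇒toℕ-≤ mono (fsuc k) =
  ≤-trans (s≤s (strictMono⇒toℕ-≤ (mono ∘ inject₁-mono-<) k)) (mono (≤̄⇒inject₁< ≤ᶠ-refl))

range-⊆ : ∀ {m n n′} → (Fin n → Fin m) → (Fin n′ → Fin m) → Set
range-⊆ ι ι′ = ∀ k → ∃ λ k′ → ι′ k′ ≡ ι k

-- Reading an inclusion of ranges as a map k ↦ k′ with ι′ k′ ≡ ι k, both
-- directions give strictly increasing self-maps of Fin n, each ≥ the identity,
-- and their composite is the identity.
strictMono-range-unique : ∀ {m n : ℕ} {ι ι′ : Fin n → Fin m} →
  ι Preserves _<_ ⟶ _<_ → ι′ Preserves _<_ ⟶ _<_ →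
  range-⊆ ι ι′ → range-⊆ ι′ ι → ∀ k → ι k ≡ ι′ k
strictMono-range-unique {n = n} {ι} {ι′} mono mono′ ι⊆ι′ ι′⊆ι k =
  trans (sym (proj₂ (ι⊆ι′ k))) (cong ι′ (toℕ-injective (≤-antisym fk≤k k≤fk)))
  where
  f g : Fin n → Fin n
  f = proj₁ ∘ ι⊆ι′
  g = proj₁ ∘ ι′⊆ι

  f-mono : f Preserves _<_ ⟶ _<_
  f-mono {a} {b} a<b = strictMono⇒reflects-< mono′
    (subst₂ _<_ (sym (proj₂ (ι⊆ι′ a))) (sym (proj₂ (ι⊆ι′ b))) (mono a<b))

  g-mono : g Preserves _<_ ⟶ _<_
  g-mono {a} {b} a<b = strictMono⇒reflects-< mono
    (subst₂ _<_ (sym (proj₂ (ι′⊆ι a))) (sym (proj₂ (ι′⊆ι b))) (mono′ a<b))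

  gfk≡k : g (f k) ≡ k
  gfk≡k = strictMono⇒injective mono (trans (proj₂ (ι′⊆ι (f k))) (proj₂ (ι⊆ι′ k)))

  k≤fk : toℕ k ≤ℕ toℕ (f k)
  k≤fk = strictMono⇒toℕ-≤ f-mono k

  fk≤k : toℕ (f k) ≤ℕ toℕ k
  fk≤k = subst₂ _≤ℕ_ refl (cong toℕ gfk≡k) (strictMono⇒toℕ-≤ g-mono (f k))

permutation-injective : ∀ {m} (σ : Permutation′ m) {i j} → σ ⟨$⟩ʳ i ≡ σ ⟨$⟩ʳ j → i ≡ j
permutation-injective σ σi≡σj =
  trans (sym (inverseˡ σ)) (trans (cong (σ ⟨$⟩ˡ_) σi≡σj) (inverseˡ σ))

module _ {c ℓ₁ ℓ₂} (F : OrderedField c ℓ₁ ℓ₂) where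
  open OrderedField F hiding (refl; sym; trans)
  open OrderedField F using () renaming (refl to ≈-refl; trans to ≈-trans)
  open RingProperties ring using (-0#≈0#; -‿distribʳ-*; -‿injective)
  open SetoidReasoning setoid

  Σ-≈0 : ∀ {k} (f : Fin k → Carrier) → (∀ i → f i ≈ 0#) → Σ[_] F f ≈ 0#
  Σ-≈0 {zero}  f f≈0 = ≈-refl
  Σ-≈0 {suc k} f f≈0 =
    ≈-trans (+-cong (f≈0 fzero) (Σ-≈0 (f ∘ fsuc) (f≈0 ∘ fsuc))) (+-identityˡ 0#)

  Σ-single : ∀ {k} (f : Fin k → Carrier) (i₀ : Fin k) →
             (∀ i → ¬ i ≡ i₀ → f i ≈ 0#) → Σ[_] F f ≈ f i₀
  Σ-single {suc k} f fzero      f≈0 =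
    ≈-trans (+-cong ≈-refl (Σ-≈0 (f ∘ fsuc) (λ i → f≈0 (fsuc i) λ ()))) (+-identityʳ _)
  Σ-single {suc k} f (fsuc i₀) f≈0 =
    ≈-trans (+-cong (f≈0 fzero λ ())
                    (Σ-single (f ∘ fsuc) i₀ λ i i≢i₀ → f≈0 (fsuc i) (i≢i₀ ∘ suc-injective)))
            (+-identityˡ _)

  Id-diagonal : ∀ {k} (i : Fin k) → Id F i i ≈ 1#
  Id-diagonal i with i ≟ i
  ... | yes _  = ≈-refl
  ... | no i≢i = ⊥-elim (i≢i refl)

  rightInverse-column-nonzero : ∀ {k} {M N : Mat F k k} → _≈ₘ_ F (_⊗_ F M N) (Id F) →
                                ∀ j → ¬ (∀ i → N i j ≈ 0#)
  rightInverse-column-nonzero {M = M} {N} MN≈Id j column≈0 = 1≉0 (begin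
    1#                ≈⟨ Id-diagonal j ⟨
    Id F j j          ≈⟨ MN≈Id j j ⟨
    _⊗_ F M N j j     ≈⟨ Σ-≈0 _ (λ i → ≈-trans (*-congˡ (column≈0 i)) (zeroʳ _)) ⟩
    0#                ∎)

  Pσ-hit : ∀ {m} (σ : Permutation′ m) i → Pσ F σ i (σ ⟨$⟩ʳ i) ≈ 1#
  Pσ-hit σ i with σ ⟨$⟩ʳ i ≟ σ ⟨$⟩ʳ i
  ... | yes _  = ≈-refl
  ... | no σi≢σi = ⊥-elim (σi≢σi refl)

  Pσ-miss : ∀ {m} (σ : Permutation′ m) i j → ¬ j ≡ σ ⟨$⟩ʳ i → Pσ F σ i j ≈ 0#
  Pσ-miss σ i j j≢σi with j ≟ σ ⟨$⟩ʳ i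
  ... | yes j≡σi = ⊥-elim (j≢σi j≡σi)
  ... | no _     = ≈-refl

  module _ {m n} (A : Mat F m n) (b : Fin m → Carrier) (σ : Permutation′ m) (I : Basis F A) where
    open Basis I

    x̃-term-miss : ∀ i k j → ¬ j ≡ σ ⟨$⟩ʳ ι k → A_I⁻¹ i k * b̃ F b σ (ι k) (fsuc j) ≈ 0#
    x̃-term-miss i k j j≢σιk = begin
      A_I⁻¹ i k * - Pσ F σ (ι k) j  ≈⟨ *-congˡ (-‿cong (Pσ-miss σ (ι k) j j≢σιk)) ⟩
      A_I⁻¹ i k * - 0#              ≈⟨ *-congˡ -0#≈0# ⟩
      A_I⁻¹ i k * 0#                ≈⟨ zeroʳ _ ⟩
      0#                            ∎

    x̃-column-σι : ∀ k i → x̃ F A b σ I i (fsuc (σ ⟨$⟩ʳ ι k)) ≈ - A_I⁻¹ i k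
    x̃-column-σι k i = begin
      x̃ F A b σ I i (fsuc (σ ⟨$⟩ʳ ι k))
        ≈⟨ Σ-single _ k (λ l l≢k → x̃-term-miss i l _
             (l≢k ∘ strictMono⇒injective increasing ∘ permutation-injective σ ∘ sym)) ⟩
      A_I⁻¹ i k * - Pσ F σ (ι k) (σ ⟨$⟩ʳ ι k)  ≈⟨ *-congˡ (-‿cong (Pσ-hit σ (ι k))) ⟩
      A_I⁻¹ i k * - 1#                        ≈⟨ -‿distribʳ-* _ _ ⟨
      - (A_I⁻¹ i k * 1#)                      ≈⟨ -‿cong (*-identityʳ _) ⟩
      - A_I⁻¹ i k                             ∎

    x̃-column-outside : ∀ j → (∀ k → ¬ j ≡ σ ⟨$⟩ʳ ι k) → ∀ i → x̃ F A b σ I i (fsuc j) ≈ 0#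
    x̃-column-outside j j∉σI i = Σ-≈0 _ λ k → x̃-term-miss i k j (j∉σI k)

  x̃-≈⇒range-⊆ : ∀ {m n} (A : Mat F m n) (b : Fin m → Carrier) (σ : Permutation′ m) (I I′ : Basis F A) →
    _≈ₘ_ F (x̃ F A b σ I) (x̃ F A b σ I′) → range-⊆ (Basis.ι I) (Basis.ι I′)
  x̃-≈⇒range-⊆ {m} A b σ I I′ x̃≈x̃′ k with any? (λ k′ → Basis.ι I′ k′ ≟ Basis.ι I k)
  ... | yes ιk∈I′ = ιk∈I′
  ... | no  ιk∉I′ = ⊥-elim (rightInverse-column-nonzero (proj₁ (Basis.invertible I)) k λ i →
        -‿injective (begin
          - Basis.A_I⁻¹ I i k                    ≈⟨ x̃-column-σι A b σ I k i ⟨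
          x̃ F A b σ I i (fsuc (σ ⟨$⟩ʳ ιk))      ≈⟨ x̃≈x̃′ i (fsuc (σ ⟨$⟩ʳ ιk)) ⟩
          x̃ F A b σ I′ i (fsuc (σ ⟨$⟩ʳ ιk))     ≈⟨ x̃-column-outside A b σ I′ (σ ⟨$⟩ʳ ιk) σιk∉σI′ i ⟩
          0#                                     ≈⟨ -0#≈0# ⟨
          - 0#                                   ∎))
    where
    ιk : Fin m
    ιk = Basis.ι I k
    σιk∉σI′ : ∀ k′ → ¬ σ ⟨$⟩ʳ ιk ≡ σ ⟨$⟩ʳ Basis.ι I′ k′
    σιk∉σI′ k′ = ιk∉I′ ∘ (k′ ,_) ∘ sym ∘ permutation-injective σ

mainTheorem8 : ∀ {c ℓ₁ ℓ₂} (F : OrderedField c ℓ₁ ℓ₂) {m n : ℕ}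
    (A : Mat F m n) (b : Fin m → OrderedField.Carrier F) (σ : Permutation′ m)
    (I I′ : Basis F A) →
    _≈ₘ_ F (x̃ F A b σ I) (x̃ F A b σ I′) →
    ∀ k → Basis.ι I k ≡ Basis.ι I′ k
mainTheorem8 F A b σ I I′ x̃≈x̃′ =
  strictMono-range-unique (Basis.increasing I) (Basis.increasing I′)
    (x̃-≈⇒range-⊆ F A b σ I I′ x̃≈x̃′)
    (x̃-≈⇒range-⊆ F A b σ I′ I (λ i j → OrderedField.sym F (x̃≈x̃′ i j)))
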